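{- Let $\Bbbk$ be a field of characteristic different from $2$, $n\ge0$. For any $J\subseteq[0,n-1]$, $$\varphi(X_J)=2^{\#J}\sum_{G}(-1)^{\#G}Q_G,$$ the sum over sparse subsets $G\subseteq[n-1]\setminus(J\cup(J+1))$.
   Context: $[m,n]=\{m,\dots,n\}$, $[n]=[1,n]$, $J+i=\{x+i:x\in J\}$. $B_n$ is the group of signed permutations (bijections $\sigma$ of $\{\pm1,\dots,\pm n\}$ with $\sigma(-i)=-\sigma(i)$); $\sigma(0)=0$, $\mathrm{Des}(\sigma)=\{i\in[0,n-1]:\sigma(i)>\sigma(i+1)\}$; $X_J=\sum_{\sigma\in B_n,\ \mathrm{Des}(\sigma)\subseteq J}\sigma$. $\varphi:\Bbbk B_n\to\Bbbk S_n$ is the linear extension of $\varphi(\sigma)(i)=|\sigma(i)|$. A set of integers is sparse if it contains no two consecutive integers. For $\sigma\in S_n$, $\sigma(0)=0$, $\mathrm{Peak}(\sigma)=\{i\in[n-1]:\sigma(i-1)<\sigma(i)>\sigma(i+1)\}$; for sparse $F\subseteq[n-1]$, $P_F=\sum_{\mathrm{Peak}(\sigma)=F}\sigma$ and $Q_F=\sum_{G\supseteq F,\ G\text{ sparse}\subseteq[n-1]}P_G$. -}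

module Defs where

open import Level using (_⊔_)
open import Data.Bool using (Bool; true; false; _∧_; _∨_; not; if_then_else_)
open import Data.Nat as ℕ using (ℕ; zero; suc)
open import Data.Integer as ℤ using (ℤ; +_)
open import Data.Fin using (Fin; toℕ)
open import Data.Fin.Subset using (Subset; _∈_; ∣_∣)
open import Data.List using (List; []; _∷_; [_]; map; concatMap; length; foldr; filter; allFin; upTo)
open import Data.Bool.ListAction using (and; or)
open import Data.Vec using (Vec; []; _∷_; lookup; toList)
open import Relation.Nullary using (¬_)
open import Data.Product using (∃)
open import Algebra.Bundles using (CommutativeRing)

record IsField {c ℓ} (R : CommutativeRing c ℓ) : Set (c ⊔ ℓ) where
  open CommutativeRing R
  field
    nontrivial : ¬ (1# ≈ 0#)
    inverse    : ∀ x → ¬ (x ≈ 0#) → ∃ λ y → x * y ≈ 1#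

_==ℕ_ : ℕ → ℕ → Bool
m ==ℕ n = Relation.Nullary.Decidable.⌊ m ℕ.≟ n ⌋
  where import Relation.Nullary.Decidable

_<ℕ_ : ℕ → ℕ → Bool
m <ℕ n = Relation.Nullary.Decidable.⌊ m ℕ.<? n ⌋
  where import Relation.Nullary.Decidable

_<ℤ_ : ℤ → ℤ → Bool
m <ℤ n = Relation.Nullary.Decidable.⌊ m ℤ.<? n ⌋
  where import Relation.Nullary.Decidable

_==L_ : List ℕ → List ℕ → Bool
[] ==L [] = true
(x ∷ xs) ==L (y ∷ ys) = (x ==ℕ y) ∧ (xs ==L ys)
_ ==L _ = false

elemℕ : ℕ → List ℕ → Bool
elemℕ x xs = or (map (x ==ℕ_) xs)

distinct : List ℕ → Bool
distinct [] = true
distinct (x ∷ xs) = not (elemℕ x xs) ∧ distinct xs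

words : {A : Set} → List A → ℕ → List (List A)
words A zero = [ [] ]
words A (suc n) = concatMap (λ a → map (a ∷_) (words A n)) A

-- entry k of a word (1-indexed) with the convention w(0) = 0
-- (and 0 out of range, never used in range-checked definitions)
at : {A : Set} → A → List A → ℕ → A
at z w zero = z
at z [] (suc k) = z
at z (x ∷ w) (suc zero) = x
at z (x ∷ w) (suc (suc k)) = at z w (suc k)

-- B_n : words σ(1)…σ(n) over {±1,…,±n} with |σ(1)|,…,|σ(n)| distinct
--       (σ(-i) = -σ(i) determines the rest).

Sn : ℕ → List (List ℕ)
Sn n = filter (λ w → distinct w Data.Bool.≟ true) (words (map suc (upTo n)) n)
  where import Data.Bool

signedVals : ℕ → List ℤ
signedVals n = concatMap (λ i → (+ suc i) ∷ ℤ.- (+ suc i) ∷ []) (upTo n)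

Bn : ℕ → List (List ℤ)
Bn n = filter (λ w → distinct (map ℤ.∣_∣ w) Data.Bool.≟ true) (words (signedVals n) n)
  where import Data.Bool

φ : List ℤ → List ℕ
φ = map ℤ.∣_∣

-- Subsets of [0,n-1] are Subset n (index i : Fin n stands for the integer i).

allSubsets : (n : ℕ) → List (Subset n)
allSubsets zero = [ [] ]
allSubsets (suc n) = concatMap (λ b → map (b ∷_) (allSubsets n)) (true ∷ false ∷ [])

mem : ∀ {n} → Subset n → Fin n → Bool
mem S i = lookup S i

subsetB : ∀ {n} → Subset n → Subset n → Bool
subsetB {n} S T = and (map (λ i → not (mem S i) ∨ mem T i) (allFin n))

eqSubsetB : ∀ {n} → Subset n → Subset n → Bool
eqSubsetB S T = subsetB S T ∧ subsetB T S

memℕ : ∀ {n} → Subset n → ℕ → Bool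
memℕ {n} S k = or (map (λ i → (toℕ i ==ℕ k) ∧ mem S i) (allFin n))

-- S ⊆ [n-1], i.e. 0 ∉ S
inPositive : ∀ {n} → Subset n → Bool
inPositive S = not (memℕ S 0)

sparse : ∀ {n} → Subset n → Bool
sparse {n} S = and (map (λ i → not (mem S i ∧ memℕ S (suc (toℕ i)))) (allFin n))

avoidsJ : ∀ {n} → Subset n → Subset n → Bool
avoidsJ {n} J G =
  and (map (λ i → not (mem G i ∧ (mem J i ∨ memℕ J (toℕ i ℕ.∸ 1) ∧ (0 <ℕ toℕ i)))) (allFin n))
  -- toℕ i ∈ J+1  iff  toℕ i ≥ 1 and toℕ i - 1 ∈ J

-- Descent set of σ ∈ B_n (σ(0) = 0): i ∈ [0,n-1] with σ(i) > σ(i+1).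

Des : (n : ℕ) → List ℤ → Subset n
Des n σ = Data.Vec.tabulate (λ i → at (+ 0) σ (suc (toℕ i)) <ℤ at (+ 0) σ (toℕ i))

-- Peak set of τ ∈ S_n (τ(0) = 0): i ∈ [n-1] with τ(i-1) < τ(i) > τ(i+1).
Peak : (n : ℕ) → List ℕ → Subset n
Peak n τ = Data.Vec.tabulate λ i →
  (0 <ℕ toℕ i) ∧ (at 0 τ (toℕ i ℕ.∸ 1) <ℕ at 0 τ (toℕ i))
               ∧ (at 0 τ (suc (toℕ i)) <ℕ at 0 τ (toℕ i))

-- Group algebras over a commutative ring R: an element of R B_n (resp. R S_n)
-- is given by its coefficient function on one-line words (zero off the group).

module GroupAlgebra {c ℓ} (R : CommutativeRing c ℓ) where
  open CommutativeRing R

  ΣR : {A : Set} → List A → (A → Carrier) → Carrier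
  ΣR xs f = foldr (λ x acc → f x + acc) 0# xs

  pow : Carrier → ℕ → Carrier
  pow x zero = 1#
  pow x (suc k) = x * pow x k

  two : Carrier
  two = 1# + 1#

  RB : Set c
  RB = List ℤ → Carrier

  RS : Set c
  RS = List ℕ → Carrier

  δB : List ℤ → RB
  δB σ w = if σ ==Z w then 1# else 0#
    where
      _==Z_ : List ℤ → List ℤ → Bool
      [] ==Z [] = true
      (x ∷ xs) ==Z (y ∷ ys) = Relation.Nullary.Decidable.⌊ x ℤ.≟ y ⌋ ∧ (xs ==Z ys)
        where import Relation.Nullary.Decidable
      _ ==Z _ = false

  δS : List ℕ → RS
  δS τ w = if τ ==L w then 1# else 0#

  sumB : List (List ℤ) → RB
  sumB σs w = ΣR σs (λ σ → δB σ w)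

  sumS : List (List ℕ) → RS
  sumS τs w = ΣR τs (λ τ → δS τ w)

  X : (n : ℕ) → Subset n → RB
  X n J = sumB (filter (λ σ → subsetB (Des n σ) J Data.Bool.≟ true) (Bn n))
    where import Data.Bool

  φlin : (n : ℕ) → RB → RS
  φlin n x τ = ΣR (Bn n) (λ σ → if φ σ ==L τ then x σ else 0#)

  P : (n : ℕ) → Subset n → RS
  P n F = sumS (filter (λ τ → eqSubsetB (Peak n τ) F Data.Bool.≟ true) (Sn n))
    where import Data.Bool

  SparseSets : (n : ℕ) → List (Subset n)
  SparseSets n = filter (λ G → (inPositive G ∧ sparse G) Data.Bool.≟ true) (allSubsets n)
    where import Data.Bool

  Q : (n : ℕ) → Subset n → RS
  Q n F τ = ΣR (SparseSets n) (λ G → if subsetB F G then P n G τ else 0#)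

  rhs : (n : ℕ) → Subset n → RS
  rhs n J τ = pow two (∣ J ∣) *
    ΣR (SparseSets n) (λ G → if avoidsJ J G then pow (- 1#) (∣ G ∣) * Q n G τ else 0#)

{-# OPTIONS --safe #-}
-- Both sides vanish at words τ that are not permutations, so fix τ ∈ S_n.  The coefficient of τ in
-- φ(X_J) counts the signings σ of τ (σ(i) = ±τ(i)) with Des σ ⊆ J.  For i ∉ J the condition
-- σ(i) < σ(i+1) fixes exactly one sign: σ(i+1) > 0 if τ ascends at i, σ(i) < 0 if τ descends there.
-- These constraints contradict each other exactly at a peak i of τ with i, i - 1 ∉ J; otherwise they
-- fix n - #J distinct signs.  Hence the count is 2^#J if Peak τ ⊆ J ∪ (J + 1) and 0 otherwise.
-- On the other side Q_G(τ) = [G ⊆ Peak τ], and every subset of a peak set is sparse, so the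
-- right-hand side is 2^#J Σ_{G ⊆ K} (-1)^#G = 2^#J [K = ∅] with K = Peak τ ∖ (J ∪ (J + 1)).
module Submission where

open import Defs
open import Algebra.Bundles using (CommutativeRing)
open import Function using (_∘_; id; Equivalence)
open import Data.Bool using (Bool; true; false; _∧_; _∨_; not; if_then_else_; T)
open import Data.Bool.Properties
  using (∧-zeroʳ; ∧-identityʳ; ∨-identityʳ; ∧-conicalˡ; ∧-conicalʳ; ∨-inverseˡ; ∧-commutativeMonoid; T-≡)
open import Algebra.Properties.CommutativeSemigroup
  (Algebra.Bundles.CommutativeMonoid.commutativeSemigroup ∧-commutativeMonoid)
  renaming (interchange to ∧-interchange)
open import Data.Bool.ListAction using (and; or)
open import Data.Nat as ℕ using (ℕ; zero; suc; _≤_; s≤s)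
open import Data.Nat.Properties using (≡ᵇ⇒≡; <⇒≤; <-asym; m≤n⇒m≤1+n)
open import Data.Integer as ℤ using (ℤ; +_; -[1+_])
open import Data.Fin using (Fin; toℕ; inject₁) renaming (zero to fzero; suc to fsuc)
open import Data.Fin.Properties using (toℕ<n; toℕ-inject₁)
open import Data.Fin.Subset using (Subset; ∣_∣)
open import Data.List using (List; []; _∷_; map; concatMap; filter; length; upTo; _++_; tabulate)
open import Data.List.Properties using (map-applyUpTo; map-id)
open import Data.List.Relation.Unary.Linked using (Linked; []; [-]; _∷_)
open import Data.Vec using (Vec; []; _∷_; lookup)
open import Data.Vec.Properties using (lookup∘tabulate)
open import Data.Empty using (⊥; ⊥-elim)
open import Data.Product using (∃; _×_; _,_; proj₁; proj₂)
open import Relation.Nullary using (¬_; yes; no)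
open import Relation.Nullary.Decidable using (isYes; isYes≗does; does; dec-true; toWitness)
import Relation.Binary.Reasoning.Setoid as SetoidReasoning
open import Relation.Binary.PropositionalEquality as ≡ using (_≡_; _≢_; refl; cong; cong₂)

≡true⇒T : ∀ {b} → b ≡ true → T b
≡true⇒T = Equivalence.from T-≡

==ℕ-≡ᵇ : ∀ m n → (m ==ℕ n) ≡ (m ℕ.≡ᵇ n)
==ℕ-≡ᵇ m n = isYes≗does (m ℕ.≟ n)

<ℕ-<ᵇ : ∀ m n → (m <ℕ n) ≡ (m ℕ.<ᵇ n)
<ℕ-<ᵇ m n = isYes≗does (m ℕ.<? n)

<ℤ-does : ∀ x y → (x <ℤ y) ≡ does (x ℤ.<? y)
<ℤ-does x y = isYes≗does (x ℤ.<? y)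

==ℕ-refl : ∀ m → (m ==ℕ m) ≡ true
==ℕ-refl m = ≡.trans (isYes≗does (m ℕ.≟ m)) (dec-true (m ℕ.≟ m) refl)

≟ℤ-refl : ∀ x → isYes (x ℤ.≟ x) ≡ true
≟ℤ-refl x = ≡.trans (isYes≗does (x ℤ.≟ x)) (dec-true (x ℤ.≟ x) refl)

==ℕ-sound : ∀ m n → (m ==ℕ n) ≡ true → m ≡ n
==ℕ-sound m n eq = ≡ᵇ⇒≡ m n (≡true⇒T (≡.trans (≡.sym (==ℕ-≡ᵇ m n)) eq))

==L-sound : ∀ xs ys → (xs ==L ys) ≡ true → xs ≡ ys
==L-sound []       []       _  = refl
==L-sound (x ∷ xs) (y ∷ ys) eq =
  cong₂ _∷_ (==ℕ-sound x y (∧-conicalˡ _ _ eq)) (==L-sound xs ys (∧-conicalʳ _ _ eq))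

<ᵇ-flip : ∀ m n → m ≢ n → (m ℕ.<ᵇ n) ≡ not (n ℕ.<ᵇ m)
<ᵇ-flip zero    zero    m≢n = ⊥-elim (m≢n refl)
<ᵇ-flip zero    (suc n) _   = refl
<ᵇ-flip (suc m) zero    _   = refl
<ᵇ-flip (suc m) (suc n) m≢n = <ᵇ-flip m n (m≢n ∘ cong suc)

andFin : (n : ℕ) → (Fin n → Bool) → Bool
andFin zero    g = true
andFin (suc n) g = g fzero ∧ andFin n (g ∘ fsuc)

orFin : (n : ℕ) → (Fin n → Bool) → Bool
orFin zero    g = false
orFin (suc n) g = g fzero ∨ orFin n (g ∘ fsuc)

and-map-tabulate : ∀ {A : Set} n (g : A → Bool) (h : Fin n → A) →
                   and (map g (tabulate h)) ≡ andFin n (g ∘ h)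
and-map-tabulate zero    g h = refl
and-map-tabulate (suc n) g h = cong (g (h fzero) ∧_) (and-map-tabulate n g (h ∘ fsuc))

or-map-tabulate : ∀ {A : Set} n (g : A → Bool) (h : Fin n → A) →
                  or (map g (tabulate h)) ≡ orFin n (g ∘ h)
or-map-tabulate zero    g h = refl
or-map-tabulate (suc n) g h = cong (g (h fzero) ∨_) (or-map-tabulate n g (h ∘ fsuc))

andFin-cong : ∀ n {f g : Fin n → Bool} → (∀ i → f i ≡ g i) → andFin n f ≡ andFin n g
andFin-cong zero    f≗g = refl
andFin-cong (suc n) f≗g = cong₂ _∧_ (f≗g fzero) (andFin-cong n (f≗g ∘ fsuc))

orFin-cong : ∀ n {f g : Fin n → Bool} → (∀ i → f i ≡ g i) → orFin n f ≡ orFin n g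
orFin-cong zero    f≗g = refl
orFin-cong (suc n) f≗g = cong₂ _∨_ (f≗g fzero) (orFin-cong n (f≗g ∘ fsuc))

andFin-true : ∀ n {f : Fin n → Bool} → (∀ i → f i ≡ true) → andFin n f ≡ true
andFin-true zero    _  = refl
andFin-true (suc n) ft = cong₂ _∧_ (ft fzero) (andFin-true n (ft ∘ fsuc))

andFin-true⁻ : ∀ n {f : Fin n → Bool} → andFin n f ≡ true → ∀ i → f i ≡ true
andFin-true⁻ (suc n) eq fzero    = ∧-conicalˡ _ _ eq
andFin-true⁻ (suc n) eq (fsuc i) = andFin-true⁻ n (∧-conicalʳ _ _ eq) i

andFin-∧ : ∀ n (f g : Fin n → Bool) → andFin n (λ i → f i ∧ g i) ≡ andFin n f ∧ andFin n g
andFin-∧ zero    f g = refl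
andFin-∧ (suc n) f g = ≡.trans (cong ((f fzero ∧ g fzero) ∧_) (andFin-∧ n (f ∘ fsuc) (g ∘ fsuc)))
                                (∧-interchange (f fzero) (g fzero) (andFin n (f ∘ fsuc)) (andFin n (g ∘ fsuc)))

orFin-true⁻ : ∀ n {f : Fin n → Bool} → orFin n f ≡ true → ∃ λ i → f i ≡ true
orFin-true⁻ (suc n) {f} eq with f fzero in f0
... | true  = fzero , f0
... | false = let i , fi = orFin-true⁻ n eq in fsuc i , fi

orFin-false : ∀ n → orFin n (λ _ → false) ≡ false
orFin-false zero    = refl
orFin-false (suc n) = orFin-false n

subsetB-andFin : ∀ {n} (S T : Subset n) → subsetB S T ≡ andFin n (λ i → not (lookup S i) ∨ lookup T i)
subsetB-andFin {n} S T = and-map-tabulate n (λ i → not (lookup S i) ∨ lookup T i) id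

subsetB-∷ : ∀ {n} s (S : Subset n) t T → subsetB (s ∷ S) (t ∷ T) ≡ (not s ∨ t) ∧ subsetB S T
subsetB-∷ s S t T = ≡.trans (subsetB-andFin (s ∷ S) (t ∷ T)) (cong ((not s ∨ t) ∧_) (≡.sym (subsetB-andFin S T)))

subsetB-refl : ∀ {n} (S : Subset n) → subsetB S S ≡ true
subsetB-refl {n} S = ≡.trans (subsetB-andFin S S) (andFin-true n (∨-inverseˡ ∘ lookup S))

subsetB-lookup : ∀ {n} {S T : Subset n} → subsetB S T ≡ true → ∀ i → lookup S i ≡ true → lookup T i ≡ true
subsetB-lookup {n} {S} {T} S⊆T i Si with andFin-true⁻ n (≡.trans (≡.sym (subsetB-andFin S T)) S⊆T) i
... | not-Si∨Ti rewrite Si = not-Si∨Ti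

eqSubsetB-∷ : ∀ {n} s (S : Subset n) t T →
              eqSubsetB (s ∷ S) (t ∷ T) ≡ ((not s ∨ t) ∧ (not t ∨ s)) ∧ eqSubsetB S T
eqSubsetB-∷ s S t T rewrite subsetB-∷ s S t T | subsetB-∷ t T s S =
  ∧-interchange (not s ∨ t) (subsetB S T) (not t ∨ s) (subsetB T S)

eqSubsetB-sound : ∀ {n} (S T : Subset n) → eqSubsetB S T ≡ true → S ≡ T
eqSubsetB-sound []      []      _  = refl
eqSubsetB-sound (s ∷ S) (t ∷ T) eq rewrite eqSubsetB-∷ s S t T =
  cong₂ _∷_ (both-ways s t (∧-conicalˡ _ (eqSubsetB S T) eq))
            (eqSubsetB-sound S T (∧-conicalʳ ((not s ∨ t) ∧ (not t ∨ s)) _ eq))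
  where
  both-ways : ∀ s t → ((not s ∨ t) ∧ (not t ∨ s)) ≡ true → s ≡ t
  both-ways true  true  _ = refl
  both-ways false false _ = refl

memℕ-orFin : ∀ {n} (S : Subset n) k → memℕ S k ≡ orFin n (λ i → (toℕ i ℕ.≡ᵇ k) ∧ lookup S i)
memℕ-orFin {n} S k = ≡.trans (or-map-tabulate n (λ i → (toℕ i ==ℕ k) ∧ lookup S i) id)
                             (orFin-cong n (λ i → cong (_∧ lookup S i) (==ℕ-≡ᵇ (toℕ i) k)))

memℕ-lookup : ∀ {n} (S : Subset n) i → memℕ S (toℕ i) ≡ lookup S i
memℕ-lookup S i = ≡.trans (memℕ-orFin S (toℕ i)) (orFin-lookup S i)
  where
  orFin-lookup : ∀ {n} (S : Subset n) i → orFin n (λ j → (toℕ j ℕ.≡ᵇ toℕ i) ∧ lookup S j) ≡ lookup S i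
  orFin-lookup (b ∷ S) fzero    rewrite orFin-false (Data.Vec.length S) = ∨-identityʳ b
  orFin-lookup (b ∷ S) (fsuc i) = orFin-lookup S i

memℕ-sound : ∀ {n} (S : Subset n) k → memℕ S k ≡ true → ∃ λ i → toℕ i ≡ k × lookup S i ≡ true
memℕ-sound {n} S k eq with orFin-true⁻ n (≡.trans (≡.sym (memℕ-orFin S k)) eq)
... | i , i≡k∧Si = i , ≡ᵇ⇒≡ (toℕ i) k (≡true⇒T (∧-conicalˡ _ _ i≡k∧Si))
                     , ∧-conicalʳ _ _ i≡k∧Si

inRange : ℕ → ℕ → Bool
inRange N       zero          = false
inRange zero    (suc t)       = false
inRange (suc N) (suc zero)    = true
inRange (suc N) (suc (suc t)) = inRange N (suc t)

isWord : ℕ → ℕ → List ℕ → Bool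
isWord N zero    []      = true
isWord N (suc k) (t ∷ τ) = inRange N t ∧ isWord N k τ
isWord N _       _       = false

isPerm : ℕ → List ℕ → Bool
isPerm n τ = isWord n n τ ∧ distinct τ

isWord-length : ∀ N k τ → isWord N k τ ≡ true → length τ ≡ k
isWord-length N zero    []      _  = refl
isWord-length N (suc k) (t ∷ τ) eq = cong suc (isWord-length N k τ (∧-conicalʳ (inRange N t) _ eq))

data AllPositive : List ℕ → Set where
  []  : AllPositive []
  _∷_ : ∀ t {τ} → AllPositive τ → AllPositive (suc t ∷ τ)

isWord-positive : ∀ N k τ → isWord N k τ ≡ true → AllPositive τ
isWord-positive N zero    []            _  = []
isWord-positive N (suc k) (suc t ∷ τ) eq = t ∷ isWord-positive N k τ (∧-conicalʳ (inRange N (suc t)) _ eq)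

distinct⇒linked : ∀ t τ → distinct (t ∷ τ) ≡ true → Linked _≢_ (t ∷ τ)
distinct⇒linked t []       _  = [-]
distinct⇒linked t (u ∷ τ) eq = t≢u ∷ distinct⇒linked u τ (∧-conicalʳ (not (elemℕ t (u ∷ τ))) _ eq)
  where
  t≢u : t ≢ u
  t≢u refl with ≡.trans (cong not (≡.sym (cong (_∨ elemℕ t τ) (==ℕ-refl t)))) (∧-conicalˡ _ _ eq)
  ... | ()

positive-distinct⇒linked : ∀ τ → AllPositive τ → distinct τ ≡ true → Linked _≢_ (0 ∷ τ)
positive-distinct⇒linked []      []       _ = [-]
positive-distinct⇒linked (suc t ∷ τ) (t ∷ _) d = (λ ()) ∷ distinct⇒linked (suc t) τ d

at-irrelevant : ∀ {A : Set} (z z′ : A) w k → suc k ≤ length w → at z w (suc k) ≡ at z′ w (suc k)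
at-irrelevant z z′ (x ∷ w) zero    _         = refl
at-irrelevant z z′ (x ∷ w) (suc k) (s≤s k<∣w∣) = at-irrelevant z z′ w k k<∣w∣

at-∷ : ∀ {A : Set} (z x : A) w k → k ≤ length w → at z (x ∷ w) (suc k) ≡ at x w k
at-∷ z x w zero    _    = refl
at-∷ z x w (suc k) k≤∣w∣ = at-irrelevant z x w k k≤∣w∣

infix 4 _<ᶻ_
_<ᶻ_ : ℤ → ℤ → Bool
x <ᶻ y = does (x ℤ.<? y)

-- σ is preceded by p, its 0-th entry; flag i of J allows a descent from entry i to entry i + 1.
descents⊆ : ∀ {m} → ℤ → List ℤ → Vec Bool m → Bool
descents⊆ p (a ∷ σ) (j ∷ J) = (not (a <ᶻ p) ∨ j) ∧ descents⊆ a σ J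
descents⊆ p _       _       = true

subsetB-Des≡descents⊆ : ∀ n (J : Subset n) σ → length σ ≡ n → subsetB (Des n σ) J ≡ descents⊆ (+ 0) σ J
subsetB-Des≡descents⊆ n J σ ∣σ∣≡n = ≡.trans (subsetB-andFin (Des n σ) J)
  (≡.trans (andFin-cong n (λ i → cong (λ b → not b ∨ lookup J i)
                                      (≡.trans (lookup∘tabulate _ i) (<ℤ-does _ _))))
           (windows n (+ 0) σ J ∣σ∣≡n))
  where
  windows : ∀ n p σ (J : Subset n) → length σ ≡ n →
            andFin n (λ i → not (at p σ (suc (toℕ i)) <ᶻ at p σ (toℕ i)) ∨ lookup J i) ≡ descents⊆ p σ J
  windows zero    p []      []      _    = refl
  windows (suc n) p (a ∷ σ) (j ∷ J) refl = cong ((not (a <ᶻ p) ∨ j) ∧_)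
    (≡.trans (andFin-cong n λ i → cong₂ (λ x y → not (x <ᶻ y) ∨ lookup J i)
                                        (at-irrelevant p a σ (toℕ i) (toℕ<n i))
                                        (at-∷ p a σ (toℕ i) (<⇒≤ (toℕ<n i))))
             (windows n a σ J refl))

near : ∀ {n} → Subset n → Fin n → Bool
near J i = lookup J i ∨ memℕ J (toℕ i ℕ.∸ 1) ∧ (0 <ℕ toℕ i)

dropNear : ∀ {n} → Subset n → Subset n → Subset n
dropNear J S = Data.Vec.tabulate (λ i → lookup S i ∧ not (near J i))

freePeaks : ∀ {n} → Subset n → List ℕ → Subset n
freePeaks {n} J τ = dropNear J (Peak n τ)

subsetB-dropNear : ∀ {n} (J G S : Subset n) → subsetB G (dropNear J S) ≡ subsetB G S ∧ avoidsJ J G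
subsetB-dropNear {n} J G S = begin
  subsetB G (dropNear J S)
    ≡⟨ subsetB-andFin G (dropNear J S) ⟩
  andFin n (λ i → not (lookup G i) ∨ lookup (dropNear J S) i)
    ≡⟨ andFin-cong n (λ i → ≡.trans (cong (not (lookup G i) ∨_) (lookup∘tabulate _ i)) (split (lookup G i))) ⟩
  andFin n (λ i → (not (lookup G i) ∨ lookup S i) ∧ not (lookup G i ∧ near J i))
    ≡⟨ andFin-∧ n _ _ ⟩
  andFin n (λ i → not (lookup G i) ∨ lookup S i) ∧ andFin n (λ i → not (lookup G i ∧ near J i))
    ≡⟨ cong₂ _∧_ (≡.sym (subsetB-andFin G S)) (≡.sym (and-map-tabulate n _ id)) ⟩
  subsetB G S ∧ avoidsJ J G ∎
  where
  open ≡.≡-Reasoning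
  split : ∀ {s b} g → not g ∨ (s ∧ not b) ≡ (not g ∨ s) ∧ not (g ∧ b)
  split false = refl
  split true  = refl

<ℕ-asym : ∀ m n → (m <ℕ n) ≡ true → (n <ℕ m) ≡ true → ⊥
<ℕ-asym m n m<n n<m = <-asym (toWitness (≡true⇒T m<n)) (toWitness (≡true⇒T n<m))

lookup-Peak : ∀ n τ i → lookup (Peak n τ) i ≡ (0 <ℕ toℕ i) ∧ (at 0 τ (toℕ i ℕ.∸ 1) <ℕ at 0 τ (toℕ i))
                                                         ∧ (at 0 τ (suc (toℕ i)) <ℕ at 0 τ (toℕ i))
lookup-Peak n τ i = lookup∘tabulate (λ k → (0 <ℕ toℕ k) ∧ (at 0 τ (toℕ k ℕ.∸ 1) <ℕ at 0 τ (toℕ k))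
                                                        ∧ (at 0 τ (suc (toℕ k)) <ℕ at 0 τ (toℕ k))) i

module _ {n : ℕ} (τ : List ℕ) where

  private
    peak-conditions : ∀ i → lookup (Peak n τ) i ≡ true →
                      (0 <ℕ toℕ i) ≡ true
                      × (at 0 τ (toℕ i ℕ.∸ 1) <ℕ at 0 τ (toℕ i)) ≡ true
                      × (at 0 τ (suc (toℕ i)) <ℕ at 0 τ (toℕ i)) ≡ true
    peak-conditions i peak = ∧₃-true _ _ _ (≡.trans (≡.sym (lookup-Peak n τ i)) peak)
      where
      ∧₃-true : ∀ a b c → a ∧ b ∧ c ≡ true → a ≡ true × b ≡ true × c ≡ true
      ∧₃-true true true true _ = refl , refl , refl

  subsetB-Peak⇒sparse : ∀ G → subsetB G (Peak n τ) ≡ true → (inPositive G ∧ sparse G) ≡ true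
  subsetB-Peak⇒sparse G G⊆Peak = cong₂ _∧_ (cong not 0∉G) G-sparse
    where
    peak : ∀ {i} → lookup G i ≡ true → lookup (Peak n τ) i ≡ true
    peak {i} = subsetB-lookup {S = G} {T = Peak n τ} G⊆Peak i

    0∉G : memℕ G 0 ≡ false
    0∉G with memℕ G 0 in 0∈G
    ... | false = refl
    ... | true with memℕ-sound G 0 0∈G
    ...   | i , i≡0 , Gi with ≡.subst (λ k → (0 <ℕ k) ≡ true) i≡0 (proj₁ (peak-conditions i (peak Gi)))
    ...     | ()

    G-sparse : sparse G ≡ true
    G-sparse = ≡.trans (and-map-tabulate n _ id) (andFin-true n no-adjacent)
      where
      no-adjacent : ∀ i → not (lookup G i ∧ memℕ G (suc (toℕ i))) ≡ true
      no-adjacent i with lookup G i in Gi | memℕ G (suc (toℕ i)) in i+1∈G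
      ... | false | _     = refl
      ... | true  | false = refl
      ... | true  | true with memℕ-sound G (suc (toℕ i)) i+1∈G
      ...   | j , j≡i+1 , Gj = ⊥-elim (<ℕ-asym _ _ (proj₂ (proj₂ (peak-conditions i (peak Gi))))
                (≡.subst (λ k → (at 0 τ (k ℕ.∸ 1) <ℕ at 0 τ k) ≡ true) j≡i+1
                         (proj₁ (proj₂ (peak-conditions j (peak Gj))))))

-- Flags as in descents⊆, with τ preceded by q.  A free peak is a peak of q ∷ τ whose two adjacent
-- steps are both unflagged.
freeDescent : ∀ {m} → ℕ → List ℕ → Vec Bool m → Bool
freeDescent q (t ∷ τ) (j ∷ J) = not j ∧ (t ℕ.<ᵇ q)
freeDescent q _       _       = false

noFreePeak : ∀ {m} → ℕ → List ℕ → Vec Bool m → Bool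
noFreePeak q (t ∷ τ) (j ∷ J) = not ((not j ∧ (q ℕ.<ᵇ t)) ∧ freeDescent t τ J) ∧ noFreePeak t τ J
noFreePeak q _       _       = true

freeDescent-0 : ∀ {m} τ (J : Vec Bool m) → freeDescent 0 τ J ≡ false
freeDescent-0 []      _       = refl
freeDescent-0 (t ∷ τ) []      = refl
freeDescent-0 (t ∷ τ) (j ∷ J) = ∧-zeroʳ (not j)

emptyᵇ : ∀ {n} → Subset n → Bool
emptyᵇ {n} K = andFin n (not ∘ lookup K)

freePeakAt : ∀ {m} → ℕ → List ℕ → Subset (suc m) → Fin m → Bool
freePeakAt p τ J i =
  (not (lookup J (inject₁ i)) ∧ (at p τ (toℕ i) ℕ.<ᵇ at p τ (suc (toℕ i))))
  ∧ (not (lookup J (fsuc i)) ∧ (at p τ (suc (suc (toℕ i))) ℕ.<ᵇ at p τ (suc (toℕ i))))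

andFin-freePeakAt : ∀ m p t τ j (J : Subset m) → length τ ≡ m →
                    andFin m (not ∘ freePeakAt p (t ∷ τ) (j ∷ J)) ≡ noFreePeak p (t ∷ τ) (j ∷ J)
andFin-freePeakAt zero    p t []      j []      _    = cong (λ b → not b ∧ true) (≡.sym (∧-zeroʳ _))
andFin-freePeakAt (suc m) p t (u ∷ τ) j (k ∷ J) ∣τ∣≡m =
  cong (not (freePeakAt p (t ∷ u ∷ τ) (j ∷ k ∷ J) fzero) ∧_)
       (≡.trans (andFin-cong m shift) (andFin-freePeakAt m t u τ k J (cong ℕ.pred ∣τ∣≡m)))
  where
  i<∣τ∣ : ∀ (i : Fin m) → suc (toℕ i) ≤ length τ
  i<∣τ∣ i = ≡.subst (suc (toℕ i) ≤_) (≡.sym (cong ℕ.pred ∣τ∣≡m)) (toℕ<n i)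

  shift : ∀ i → not (freePeakAt p (t ∷ u ∷ τ) (j ∷ k ∷ J) (fsuc i)) ≡ not (freePeakAt t (u ∷ τ) (k ∷ J) i)
  shift i rewrite at-∷ p t (u ∷ τ) (toℕ i) (m≤n⇒m≤1+n (<⇒≤ (i<∣τ∣ i)))
                | at-∷ p t (u ∷ τ) (suc (toℕ i)) (s≤s (<⇒≤ (i<∣τ∣ i)))
                | at-∷ p t (u ∷ τ) (suc (suc (toℕ i))) (s≤s (i<∣τ∣ i)) = refl

emptyᵇ-freePeaks : ∀ n τ (J : Subset n) → length τ ≡ n → emptyᵇ (freePeaks J τ) ≡ noFreePeak 0 τ J
emptyᵇ-freePeaks zero    []      []      _      = refl
emptyᵇ-freePeaks (suc m) (t ∷ τ) (j ∷ J) ∣τ∣≡n =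
  cong (true ∧_) (≡.trans (andFin-cong m (cong not ∘ lookup-fsuc))
                          (andFin-freePeakAt m 0 t τ j J (cong ℕ.pred ∣τ∣≡n)))
  where
  K = freePeaks (j ∷ J) (t ∷ τ)

  rearrange : ∀ a c d e → (a ∧ c) ∧ not (d ∨ e) ≡ (not e ∧ a) ∧ (not d ∧ c)
  rearrange a c true  e     = ≡.trans (∧-zeroʳ _) (≡.sym (∧-zeroʳ _))
  rearrange a c false true  = ∧-zeroʳ _
  rearrange a c false false = ∧-identityʳ _

  lookup-fsuc : ∀ i → lookup K (fsuc i) ≡ freePeakAt 0 (t ∷ τ) (j ∷ J) i
  lookup-fsuc i = begin
    lookup K (fsuc i)
      ≡⟨ lookup∘tabulate (λ k → lookup (Peak (suc m) (t ∷ τ)) k ∧ not (near (j ∷ J) k)) (fsuc i) ⟩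
    lookup (Peak (suc m) (t ∷ τ)) (fsuc i) ∧ not (near (j ∷ J) (fsuc i))
      ≡⟨ cong₂ (λ x y → x ∧ not y)
               (≡.trans (lookup-Peak (suc m) (t ∷ τ) (fsuc i))
                        (cong₂ _∧_ (<ℕ-<ᵇ (at0 (toℕ i)) (at0 (suc (toℕ i))))
                                   (<ℕ-<ᵇ (at0 (suc (suc (toℕ i)))) (at0 (suc (toℕ i))))))
               (cong (lookup J i ∨_) near-inject) ⟩
    (rises ∧ falls) ∧ not (lookup J i ∨ lookup (j ∷ J) (inject₁ i))
      ≡⟨ rearrange rises falls (lookup J i) (lookup (j ∷ J) (inject₁ i)) ⟩
    freePeakAt 0 (t ∷ τ) (j ∷ J) i ∎
    where
    open ≡.≡-Reasoning
    at0 = at 0 (t ∷ τ)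
    rises = at0 (toℕ i) ℕ.<ᵇ at0 (suc (toℕ i))
    falls = at0 (suc (suc (toℕ i))) ℕ.<ᵇ at0 (suc (toℕ i))
    near-inject : memℕ (j ∷ J) (toℕ i) ∧ true ≡ lookup (j ∷ J) (inject₁ i)
    near-inject = ≡.trans (∧-identityʳ _)
                  (≡.trans (cong (memℕ (j ∷ J)) (≡.sym (toℕ-inject₁ i))) (memℕ-lookup (j ∷ J) (inject₁ i)))

liftWords : {A : Set} → (ℕ → List A) → List ℕ → List (List A)
liftWords lifts []      = [] ∷ []
liftWords lifts (t ∷ τ) = concatMap (λ a → map (a ∷_) (liftWords lifts τ)) (lifts t)

signings : List ℕ → List (List ℤ)
signings = liftWords (λ t → + t ∷ ℤ.- (+ t) ∷ [])

data Signing : List ℤ → List ℕ → Set where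
  []   : Signing [] []
  _+∷_ : ∀ t {σ τ} → Signing σ τ → Signing (+ suc t ∷ σ) (suc t ∷ τ)
  _-∷_ : ∀ t {σ τ} → Signing σ τ → Signing (-[1+ t ] ∷ σ) (suc t ∷ τ)

Signing-φ : ∀ {σ τ} → Signing σ τ → φ σ ≡ τ
Signing-φ []       = refl
Signing-φ (t +∷ s) = cong (suc t ∷_) (Signing-φ s)
Signing-φ (t -∷ s) = cong (suc t ∷_) (Signing-φ s)

Signing-length : ∀ {σ τ} → Signing σ τ → length σ ≡ length τ
Signing-length []       = refl
Signing-length (t +∷ s) = cong suc (Signing-length s)
Signing-length (t -∷ s) = cong suc (Signing-length s)

module Coefficients {c ℓ} (R : CommutativeRing c ℓ) where

  open CommutativeRing R renaming (refl to ≈-refl; sym to ≈-sym; trans to ≈-trans)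
  open GroupAlgebra R
  open import Relation.Binary.Reasoning.Setoid setoid
  open import Algebra.Properties.Ring (CommutativeRing.ring R) using (-1*x≈-x)

  guard : Bool → Carrier → Carrier
  guard b x = if b then x else 0#

  𝟙 : Bool → Carrier
  𝟙 b = guard b 1#

  guard-cong : ∀ b {x y} → x ≈ y → guard b x ≈ guard b y
  guard-cong true  x≈y = x≈y
  guard-cong false _   = ≈-refl

  guard-+ : ∀ b x y → guard b x + guard b y ≈ guard b (x + y)
  guard-+ true  x y = ≈-refl
  guard-+ false x y = +-identityˡ 0#

  guard-under : ∀ b {x y} → (b ≡ true → x ≈ y) → guard b x ≈ guard b y
  guard-under true  x≈y = x≈y refl
  guard-under false _   = ≈-refl

  guard-𝟙-∧ : ∀ a b → guard a (𝟙 (a ∧ b)) ≡ guard a (𝟙 b)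
  guard-𝟙-∧ true  b = refl
  guard-𝟙-∧ false b = refl

  guard-0# : ∀ b → guard b 0# ≈ 0#
  guard-0# true  = ≈-refl
  guard-0# false = ≈-refl

  guard-∧ : ∀ a b x → guard (a ∧ b) x ≡ guard a (guard b x)
  guard-∧ true  b x = refl
  guard-∧ false b x = refl

  guard-comm : ∀ a b x → guard a (guard b x) ≡ guard b (guard a x)
  guard-comm true  b     x = refl
  guard-comm false true  x = refl
  guard-comm false false x = refl

  *-guardˡ : ∀ b x y → x * guard b y ≈ guard b (x * y)
  *-guardˡ true  x y = ≈-refl
  *-guardˡ false x y = zeroʳ x

  *-𝟙ʳ : ∀ b x → x * 𝟙 b ≈ guard b x
  *-𝟙ʳ b x = ≈-trans (*-guardˡ b x 1#) (guard-cong b (*-identityʳ x))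

  module _ {A : Set} where

    ΣR-cong : ∀ (xs : List A) {f g : A → Carrier} → (∀ x → f x ≈ g x) → ΣR xs f ≈ ΣR xs g
    ΣR-cong []       f≈g = ≈-refl
    ΣR-cong (x ∷ xs) f≈g = +-cong (f≈g x) (ΣR-cong xs f≈g)

    ΣR-0# : ∀ (xs : List A) {f} → (∀ x → f x ≈ 0#) → ΣR xs f ≈ 0#
    ΣR-0# []       _    = ≈-refl
    ΣR-0# (x ∷ xs) f≈0 = ≈-trans (+-cong (f≈0 x) (ΣR-0# xs f≈0)) (+-identityˡ 0#)

    ΣR-++ : ∀ (xs ys : List A) f → ΣR (xs ++ ys) f ≈ ΣR xs f + ΣR ys f
    ΣR-++ []       ys f = ≈-sym (+-identityˡ _)
    ΣR-++ (x ∷ xs) ys f = ≈-trans (+-congˡ (ΣR-++ xs ys f)) (≈-sym (+-assoc _ _ _))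

    ΣR-map : ∀ {B : Set} (g : B → A) (xs : List B) f → ΣR (map g xs) f ≡ ΣR xs (f ∘ g)
    ΣR-map g []       f = refl
    ΣR-map g (x ∷ xs) f = cong (λ s → f (g x) + s) (ΣR-map g xs f)

    ΣR-concatMap : ∀ {B : Set} (g : B → List A) (xs : List B) f →
                   ΣR (concatMap g xs) f ≈ ΣR xs (λ x → ΣR (g x) f)
    ΣR-concatMap g []       f = ≈-refl
    ΣR-concatMap g (x ∷ xs) f = ≈-trans (ΣR-++ (g x) (concatMap g xs) f) (+-congˡ (ΣR-concatMap g xs f))

    ΣR-filter : ∀ (b : A → Bool) (xs : List A) f →
                ΣR (filter (λ x → b x Data.Bool.≟ true) xs) f ≈ ΣR xs (λ x → guard (b x) (f x))
    ΣR-filter b []       f = ≈-refl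
    ΣR-filter b (x ∷ xs) f with b x
    ... | true  = +-congˡ (ΣR-filter b xs f)
    ... | false = ≈-trans (ΣR-filter b xs f) (≈-sym (+-identityˡ _))

    ΣR-*ˡ : ∀ (xs : List A) a f → a * ΣR xs f ≈ ΣR xs (λ x → a * f x)
    ΣR-*ˡ []       a f = zeroʳ a
    ΣR-*ˡ (x ∷ xs) a f = ≈-trans (distribˡ a _ _) (+-congˡ (ΣR-*ˡ xs a f))

    ΣR-guard : ∀ (xs : List A) b f → ΣR xs (λ x → guard b (f x)) ≈ guard b (ΣR xs f)
    ΣR-guard xs true  f = ≈-refl
    ΣR-guard xs false f = ΣR-0# xs (λ _ → ≈-refl)

  ΣR-allSubsets-suc : ∀ n (f : Subset (suc n) → Carrier) →
                      ΣR (allSubsets (suc n)) f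
                      ≈ ΣR (allSubsets n) (f ∘ (true ∷_)) + ΣR (allSubsets n) (f ∘ (false ∷_))
  ΣR-allSubsets-suc n f = ≈-trans (ΣR-concatMap (λ b → map (b ∷_) (allSubsets n)) (true ∷ false ∷ []) f)
    (+-cong (reflexive (ΣR-map _ (allSubsets n) f))
            (≈-trans (+-identityʳ _) (reflexive (ΣR-map _ (allSubsets n) f))))

  ΣR-eqSubsetB : ∀ n (S : Subset n) x → ΣR (allSubsets n) (λ H → guard (eqSubsetB S H) x) ≈ x
  ΣR-eqSubsetB zero    []      x = +-identityʳ x
  ΣR-eqSubsetB (suc n) (s ∷ S) x = begin
    ΣR (allSubsets (suc n)) (λ H → guard (eqSubsetB (s ∷ S) H) x)
      ≈⟨ ΣR-allSubsets-suc n _ ⟩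
    ΣR (allSubsets n) (λ H → guard (eqSubsetB (s ∷ S) (true ∷ H)) x)
      + ΣR (allSubsets n) (λ H → guard (eqSubsetB (s ∷ S) (false ∷ H)) x)
      ≈⟨ +-cong (peel true) (peel false) ⟩
    guard (not s ∨ true) (guard (false ∨ s) Σ) + guard (not s ∨ false) (guard (true ∨ s) Σ)
      ≈⟨ exactly-one s ⟩
    Σ
      ≈⟨ ΣR-eqSubsetB n S x ⟩
    x ∎
    where
    Σ = ΣR (allSubsets n) (λ H → guard (eqSubsetB S H) x)
    peel : ∀ b → ΣR (allSubsets n) (λ H → guard (eqSubsetB (s ∷ S) (b ∷ H)) x)
                 ≈ guard (not s ∨ b) (guard (not b ∨ s) Σ)
    peel b = ≈-trans (ΣR-cong (allSubsets n) (λ H → reflexive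
                        (≡.trans (cong (λ e → guard e x) (eqSubsetB-∷ s S b H))
                        (≡.trans (guard-∧ ((not s ∨ b) ∧ (not b ∨ s)) (eqSubsetB S H) x)
                                 (guard-∧ (not s ∨ b) (not b ∨ s) _)))))
             (≈-trans (ΣR-guard (allSubsets n) (not s ∨ b) _)
                      (guard-cong (not s ∨ b) (ΣR-guard (allSubsets n) (not b ∨ s) _)))
    exactly-one : ∀ s → guard (not s ∨ true) (guard (false ∨ s) Σ)
                        + guard (not s ∨ false) (guard (true ∨ s) Σ) ≈ Σ
    exactly-one true  = +-identityʳ Σ
    exactly-one false = +-identityˡ Σ

  ΣR-alternating : ∀ n (K : Subset n) →
                   ΣR (allSubsets n) (λ G → guard (subsetB G K) (pow (- 1#) ∣ G ∣)) ≈ 𝟙 (emptyᵇ K)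
  ΣR-alternating zero    []      = +-identityʳ 1#
  ΣR-alternating (suc n) (k ∷ K) = begin
    ΣR (allSubsets (suc n)) (λ G → guard (subsetB G (k ∷ K)) (pow (- 1#) ∣ G ∣))
      ≈⟨ ΣR-allSubsets-suc n _ ⟩
    ΣR (allSubsets n) (λ G → guard (subsetB (true ∷ G) (k ∷ K)) (- 1# * pow (- 1#) ∣ G ∣))
      + ΣR (allSubsets n) (λ G → guard (subsetB (false ∷ G) (k ∷ K)) (pow (- 1#) ∣ G ∣))
      ≈⟨ +-cong with-k without-k ⟩
    guard k (- 1# * Σ) + Σ
      ≈⟨ cancel k ⟩
    𝟙 (not k ∧ emptyᵇ K) ∎
    where
    Σ = ΣR (allSubsets n) (λ G → guard (subsetB G K) (pow (- 1#) ∣ G ∣))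
    with-k : ΣR (allSubsets n) (λ G → guard (subsetB (true ∷ G) (k ∷ K)) (- 1# * pow (- 1#) ∣ G ∣))
             ≈ guard k (- 1# * Σ)
    with-k = begin
      ΣR (allSubsets n) (λ G → guard (subsetB (true ∷ G) (k ∷ K)) (- 1# * pow (- 1#) ∣ G ∣))
        ≈⟨ ΣR-cong (allSubsets n) (λ G → ≈-trans
             (reflexive (≡.trans (cong (λ e → guard e _) (subsetB-∷ true G k K)) (guard-∧ k _ _)))
             (guard-cong k (≈-sym (*-guardˡ (subsetB G K) (- 1#) _)))) ⟩
      ΣR (allSubsets n) (λ G → guard k (- 1# * guard (subsetB G K) (pow (- 1#) ∣ G ∣)))
        ≈⟨ ΣR-guard (allSubsets n) k _ ⟩
      guard k (ΣR (allSubsets n) (λ G → - 1# * guard (subsetB G K) (pow (- 1#) ∣ G ∣)))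
        ≈⟨ guard-cong k (≈-sym (ΣR-*ˡ (allSubsets n) (- 1#) _)) ⟩
      guard k (- 1# * Σ) ∎
    without-k : ΣR (allSubsets n) (λ G → guard (subsetB (false ∷ G) (k ∷ K)) (pow (- 1#) ∣ G ∣)) ≈ Σ
    without-k = ΣR-cong (allSubsets n) (λ G → reflexive (cong (λ e → guard e _) (subsetB-∷ false G k K)))
    cancel : ∀ k → guard k (- 1# * Σ) + Σ ≈ 𝟙 (not k ∧ emptyᵇ K)
    cancel true  = ≈-trans (+-congʳ (-1*x≈-x Σ)) (-‿inverseˡ Σ)
    cancel false = ≈-trans (+-identityˡ Σ) (ΣR-alternating n K)

  ΣR-upTo-select : ∀ N t (K : ℕ → Carrier) →
                   ΣR (upTo N) (λ i → guard (suc i ℕ.≡ᵇ t) (K (suc i))) ≈ guard (inRange N t) (K t)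
  ΣR-upTo-select zero    zero    K = ≈-refl
  ΣR-upTo-select zero    (suc t) K = ≈-refl
  ΣR-upTo-select (suc N) t       K = ≈-trans (+-congˡ (reflexive (≡.trans
      (cong (λ is → ΣR is _) (≡.sym (map-applyUpTo id suc N))) (ΣR-map suc (upTo N) _))))
    (step t)
    where
    step : ∀ t → guard (1 ℕ.≡ᵇ t) (K 1) + ΣR (upTo N) (λ i → guard (suc (suc i) ℕ.≡ᵇ t) (K (suc (suc i))))
                 ≈ guard (inRange (suc N) t) (K t)
    step zero          = ≈-trans (+-identityˡ _) (ΣR-0# (upTo N) (λ _ → ≈-refl))
    step (suc zero)    = ≈-trans (+-congˡ (ΣR-0# (upTo N) (λ _ → ≈-refl))) (+-identityʳ _)
    step (suc (suc t)) = ≈-trans (+-identityˡ _) (ΣR-upTo-select N (suc t) (K ∘ suc))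

  ΣR-words-fibre : ∀ {A : Set} (letters : List A) (h : A → ℕ) (lifts : ℕ → List A) N →
    (∀ t (H : A → Carrier) →
       ΣR letters (λ a → guard (h a ==ℕ t) (H a)) ≈ guard (inRange N t) (ΣR (lifts t) H)) →
    ∀ k τ (f : List A → Carrier) →
    ΣR (words letters k) (λ w → guard (map h w ==L τ) (f w)) ≈ guard (isWord N k τ) (ΣR (liftWords lifts τ) f)
  ΣR-words-fibre letters h lifts N ΣR-letters = fibre
    where
    fibre : ∀ k τ f → ΣR (words letters k) (λ w → guard (map h w ==L τ) (f w))
                      ≈ guard (isWord N k τ) (ΣR (liftWords lifts τ) f)
    fibre zero    []      f = ≈-refl
    fibre zero    (t ∷ τ) f = +-identityˡ 0#
    fibre (suc k) []      f = ≈-trans (ΣR-concatMap _ letters _)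
      (ΣR-0# letters (λ a → ≈-trans (reflexive (ΣR-map (a ∷_) (words letters k) _))
                                     (ΣR-0# (words letters k) (λ _ → ≈-refl))))
    fibre (suc k) (t ∷ τ) f = begin
      ΣR (concatMap (λ a → map (a ∷_) (words letters k)) letters) (λ w → guard (map h w ==L (t ∷ τ)) (f w))
        ≈⟨ ΣR-concatMap _ letters _ ⟩
      ΣR letters (λ a → ΣR (map (a ∷_) (words letters k)) (λ w → guard (map h w ==L (t ∷ τ)) (f w)))
        ≈⟨ ΣR-cong letters (λ a → ≈-trans (reflexive (ΣR-map (a ∷_) (words letters k) _))
             (≈-trans (ΣR-cong (words letters k) (λ w → reflexive (guard-∧ (h a ==ℕ t) _ _)))
                      (ΣR-guard (words letters k) (h a ==ℕ t) _))) ⟩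
      ΣR letters (λ a → guard (h a ==ℕ t) (ΣR (words letters k) (λ w → guard (map h w ==L τ) (f (a ∷ w)))))
        ≈⟨ ΣR-cong letters (λ a → guard-cong (h a ==ℕ t) (fibre k τ (f ∘ (a ∷_)))) ⟩
      ΣR letters (λ a → guard (h a ==ℕ t) (guard (isWord N k τ) (ΣR (liftWords lifts τ) (f ∘ (a ∷_)))))
        ≈⟨ ΣR-letters t _ ⟩
      guard (inRange N t) (ΣR (lifts t) (λ a → guard (isWord N k τ) (ΣR (liftWords lifts τ) (f ∘ (a ∷_)))))
        ≈⟨ guard-cong (inRange N t) (ΣR-guard (lifts t) (isWord N k τ) _) ⟩
      guard (inRange N t) (guard (isWord N k τ) (ΣR (lifts t) (λ a → ΣR (liftWords lifts τ) (f ∘ (a ∷_)))))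
        ≈⟨ reflexive (≡.sym (guard-∧ (inRange N t) (isWord N k τ) _)) ⟩
      guard (isWord N (suc k) (t ∷ τ)) (ΣR (lifts t) (λ a → ΣR (liftWords lifts τ) (f ∘ (a ∷_))))
        ≈⟨ guard-cong (isWord N (suc k) (t ∷ τ))
             (≈-sym (≈-trans (ΣR-concatMap _ (lifts t) f)
                              (ΣR-cong (lifts t) (λ a → reflexive (ΣR-map (a ∷_) (liftWords lifts τ) f))))) ⟩
      guard (isWord N (suc k) (t ∷ τ)) (ΣR (liftWords lifts (t ∷ τ)) f) ∎

  ΣR-signedVals : ∀ N t (H : ℤ → Carrier) →
                  ΣR (signedVals N) (λ a → guard (ℤ.∣ a ∣ ==ℕ t) (H a))
                  ≈ guard (inRange N t) (ΣR (+ t ∷ ℤ.- (+ t) ∷ []) H)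
  ΣR-signedVals N t H = begin
    ΣR (signedVals N) (λ a → guard (ℤ.∣ a ∣ ==ℕ t) (H a))
      ≈⟨ ΣR-concatMap _ (upTo N) _ ⟩
    ΣR (upTo N) (λ i → guard (suc i ==ℕ t) (H (+ suc i)) + (guard (suc i ==ℕ t) (H -[1+ i ]) + 0#))
      ≈⟨ ΣR-cong (upTo N) (λ i → ≈-trans (+-congˡ (+-identityʳ _))
                                   (≈-trans (guard-+ (suc i ==ℕ t) _ _)
                                   (reflexive (cong (λ b → guard b _) (==ℕ-≡ᵇ (suc i) t))))) ⟩
    ΣR (upTo N) (λ i → guard (suc i ℕ.≡ᵇ t) (H (+ suc i) + H -[1+ i ]))
      ≈⟨ ΣR-upTo-select N t (λ s → H (+ s) + H (ℤ.- (+ s))) ⟩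
    guard (inRange N t) (H (+ t) + H (ℤ.- (+ t)))
      ≈⟨ guard-cong (inRange N t) (+-congˡ (≈-sym (+-identityʳ _))) ⟩
    guard (inRange N t) (ΣR (+ t ∷ ℤ.- (+ t) ∷ []) H) ∎

  ΣR-positives : ∀ N t (H : ℕ → Carrier) →
                 ΣR (map suc (upTo N)) (λ a → guard (id a ==ℕ t) (H a)) ≈ guard (inRange N t) (ΣR (t ∷ []) H)
  ΣR-positives N t H = begin
    ΣR (map suc (upTo N)) (λ a → guard (a ==ℕ t) (H a))
      ≡⟨ ΣR-map suc (upTo N) _ ⟩
    ΣR (upTo N) (λ i → guard (suc i ==ℕ t) (H (suc i)))
      ≈⟨ ΣR-cong (upTo N) (λ i → reflexive (cong (λ b → guard b _) (==ℕ-≡ᵇ (suc i) t))) ⟩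
    ΣR (upTo N) (λ i → guard (suc i ℕ.≡ᵇ t) (H (suc i)))
      ≈⟨ ΣR-upTo-select N t H ⟩
    guard (inRange N t) (H t)
      ≈⟨ guard-cong (inRange N t) (≈-sym (+-identityʳ _)) ⟩
    guard (inRange N t) (ΣR (t ∷ []) H) ∎

  ΣR-signedWords : ∀ N k τ (f : List ℤ → Carrier) →
    ΣR (words (signedVals N) k) (λ σ → guard (φ σ ==L τ) (f σ)) ≈ guard (isWord N k τ) (ΣR (signings τ) f)
  ΣR-signedWords N = ΣR-words-fibre (signedVals N) ℤ.∣_∣ _ N (ΣR-signedVals N)

  ΣR-positiveWords : ∀ N k τ x → ΣR (words (map suc (upTo N)) k) (λ w → guard (w ==L τ) x) ≈ guard (isWord N k τ) x
  ΣR-positiveWords N k τ x = begin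
    ΣR (words letters k) (λ w → guard (w ==L τ) x)
      ≈⟨ ΣR-cong (words letters k) (λ w → reflexive (cong (λ v → guard (v ==L τ) x) (≡.sym (map-id w)))) ⟩
    ΣR (words letters k) (λ w → guard (map id w ==L τ) x)
      ≈⟨ ΣR-words-fibre letters id (_∷ []) N (ΣR-positives N) k τ (λ _ → x) ⟩
    guard (isWord N k τ) (ΣR (liftWords (_∷ []) τ) (λ _ → x))
      ≈⟨ guard-cong (isWord N k τ) (unique-lift τ) ⟩
    guard (isWord N k τ) x ∎
    where
    letters = map suc (upTo N)
    unique-lift : ∀ τ → ΣR (liftWords (_∷ []) τ) (λ _ → x) ≈ x
    unique-lift []      = +-identityʳ x
    unique-lift (t ∷ τ) = ≈-trans (ΣR-concatMap (λ a → map (a ∷_) (liftWords (_∷ []) τ)) (t ∷ []) (λ _ → x))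
      (≈-trans (+-identityʳ _) (≈-trans (reflexive (ΣR-map (t ∷_) (liftWords (_∷ []) τ) _)) (unique-lift τ)))

  ΣR-signings-suc : ∀ t τ (f : List ℤ → Carrier) →
    ΣR (signings (suc t ∷ τ)) f ≈ ΣR (signings τ) (f ∘ (+ suc t ∷_)) + ΣR (signings τ) (f ∘ (-[1+ t ] ∷_))
  ΣR-signings-suc t τ f = ≈-trans (ΣR-concatMap (λ a → map (a ∷_) (signings τ)) (+ suc t ∷ -[1+ t ] ∷ []) f)
    (+-cong (reflexive (ΣR-map _ (signings τ) f))
            (≈-trans (+-identityʳ _) (reflexive (ΣR-map _ (signings τ) f))))

  ΣR-signings-cong : ∀ {τ} → AllPositive τ → {f g : List ℤ → Carrier} →
                     (∀ σ → Signing σ τ → f σ ≈ g σ) → ΣR (signings τ) f ≈ ΣR (signings τ) g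
  ΣR-signings-cong []               f≈g = +-congʳ (f≈g [] [])
  ΣR-signings-cong {suc t ∷ τ} (t ∷ ps) {f} {g} f≈g = begin
    ΣR (signings (suc t ∷ τ)) f
      ≈⟨ ΣR-signings-suc t τ f ⟩
    ΣR (signings τ) (f ∘ (+ suc t ∷_)) + ΣR (signings τ) (f ∘ (-[1+ t ] ∷_))
      ≈⟨ +-cong (ΣR-signings-cong ps (λ σ s → f≈g _ (t +∷ s)))
                (ΣR-signings-cong ps (λ σ s → f≈g _ (t -∷ s))) ⟩
    ΣR (signings τ) (g ∘ (+ suc t ∷_)) + ΣR (signings τ) (g ∘ (-[1+ t ] ∷_))
      ≈⟨ ΣR-signings-suc t τ g ⟨
    ΣR (signings (suc t ∷ τ)) g ∎

  δB-∷ : ∀ x xs y ys → δB (x ∷ xs) (y ∷ ys) ≡ guard (isYes (x ℤ.≟ y)) (δB xs ys)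
  δB-∷ x xs y ys = guard-∧ (isYes (x ℤ.≟ y)) _ 1#

  δB-same-head : ∀ a σ′ σ → δB (a ∷ σ′) (a ∷ σ) ≡ δB σ′ σ
  δB-same-head a σ′ σ = ≡.trans (δB-∷ a σ′ a σ) (cong (λ b → guard b (δB σ′ σ)) (≟ℤ-refl a))

  ΣR-signings-δB : ∀ {σ τ} → Signing σ τ → (h : List ℤ → Carrier) →
                   ΣR (signings τ) (λ σ′ → δB σ′ σ * h σ′) ≈ h σ
  ΣR-signings-δB [] h = ≈-trans (+-identityʳ _) (*-identityˡ _)
  ΣR-signings-δB {+ suc t ∷ σ} {suc t ∷ τ} (t +∷ s) h = begin
    ΣR (signings (suc t ∷ τ)) (λ σ′ → δB σ′ (+ suc t ∷ σ) * h σ′)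
      ≈⟨ ΣR-signings-suc t τ _ ⟩
    ΣR (signings τ) (λ σ′ → δB (+ suc t ∷ σ′) (+ suc t ∷ σ) * h (+ suc t ∷ σ′))
      + ΣR (signings τ) (λ σ′ → δB (-[1+ t ] ∷ σ′) (+ suc t ∷ σ) * h (-[1+ t ] ∷ σ′))
      ≈⟨ +-cong (ΣR-cong (signings τ) (λ σ′ → *-congʳ (reflexive (δB-same-head (+ suc t) σ′ σ))))
                (ΣR-0# (signings τ) (λ _ → zeroˡ _)) ⟩
    ΣR (signings τ) (λ σ′ → δB σ′ σ * h (+ suc t ∷ σ′)) + 0#
      ≈⟨ +-identityʳ _ ⟩
    ΣR (signings τ) (λ σ′ → δB σ′ σ * h (+ suc t ∷ σ′))
      ≈⟨ ΣR-signings-δB s (h ∘ (+ suc t ∷_)) ⟩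
    h (+ suc t ∷ σ) ∎
  ΣR-signings-δB { -[1+ t ] ∷ σ} {suc t ∷ τ} (t -∷ s) h = begin
    ΣR (signings (suc t ∷ τ)) (λ σ′ → δB σ′ (-[1+ t ] ∷ σ) * h σ′)
      ≈⟨ ΣR-signings-suc t τ _ ⟩
    ΣR (signings τ) (λ σ′ → δB (+ suc t ∷ σ′) (-[1+ t ] ∷ σ) * h (+ suc t ∷ σ′))
      + ΣR (signings τ) (λ σ′ → δB (-[1+ t ] ∷ σ′) (-[1+ t ] ∷ σ) * h (-[1+ t ] ∷ σ′))
      ≈⟨ +-cong (ΣR-0# (signings τ) (λ _ → zeroˡ _))
                (ΣR-cong (signings τ) (λ σ′ → *-congʳ (reflexive (δB-same-head -[1+ t ] σ′ σ)))) ⟩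
    0# + ΣR (signings τ) (λ σ′ → δB σ′ σ * h (-[1+ t ] ∷ σ′))
      ≈⟨ +-identityˡ _ ⟩
    ΣR (signings τ) (λ σ′ → δB σ′ σ * h (-[1+ t ] ∷ σ′))
      ≈⟨ ΣR-signings-δB s (h ∘ (-[1+ t ] ∷_)) ⟩
    h (-[1+ t ] ∷ σ) ∎

  δB-φ≢ : ∀ σ′ σ → (φ σ′ ==L φ σ) ≡ false → δB σ′ σ ≡ 0#
  δB-φ≢ []       []      ()
  δB-φ≢ []       (y ∷ σ) _ = refl
  δB-φ≢ (x ∷ σ′) []      _ = refl
  δB-φ≢ (x ∷ σ′) (y ∷ σ) φ≢ rewrite δB-∷ x σ′ y σ with x ℤ.≟ y
  ... | no  _    = refl
  ... | yes refl rewrite ==ℕ-refl ℤ.∣ x ∣ = δB-φ≢ σ′ σ φ≢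

  sumB-at-signing : ∀ n (ok : List ℤ → Bool) {σ τ} → Signing σ τ →
                    sumB (filter (λ σ′ → ok σ′ Data.Bool.≟ true) (Bn n)) σ
                    ≈ guard (isWord n n τ) (𝟙 (distinct τ ∧ ok σ))
  sumB-at-signing n ok {σ} {τ} s = begin
    ΣR (filter (λ σ′ → ok σ′ Data.Bool.≟ true) (Bn n)) (λ σ′ → δB σ′ σ)
      ≈⟨ ΣR-filter ok (Bn n) _ ⟩
    ΣR (Bn n) (λ σ′ → guard (ok σ′) (δB σ′ σ))
      ≈⟨ ΣR-filter (distinct ∘ φ) (words (signedVals n) n) _ ⟩
    ΣR (words (signedVals n) n) (λ σ′ → guard (distinct (φ σ′)) (guard (ok σ′) (δB σ′ σ)))
      ≈⟨ ΣR-cong (words (signedVals n) n) same-fibre ⟩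
    ΣR (words (signedVals n) n) (λ σ′ → guard (φ σ′ ==L τ) (δB σ′ σ * 𝟙 (distinct (φ σ′) ∧ ok σ′)))
      ≈⟨ ΣR-signedWords n n τ _ ⟩
    guard (isWord n n τ) (ΣR (signings τ) (λ σ′ → δB σ′ σ * 𝟙 (distinct (φ σ′) ∧ ok σ′)))
      ≈⟨ guard-cong (isWord n n τ) (ΣR-signings-δB s _) ⟩
    guard (isWord n n τ) (𝟙 (distinct (φ σ) ∧ ok σ))
      ≡⟨ cong (λ v → guard (isWord n n τ) (𝟙 (distinct v ∧ ok σ))) (Signing-φ s) ⟩
    guard (isWord n n τ) (𝟙 (distinct τ ∧ ok σ)) ∎
    where
    same-fibre : ∀ σ′ → guard (distinct (φ σ′)) (guard (ok σ′) (δB σ′ σ))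
                        ≈ guard (φ σ′ ==L τ) (δB σ′ σ * 𝟙 (distinct (φ σ′) ∧ ok σ′))
    same-fibre σ′ with φ σ′ ==L τ in φσ′≡τ
    ... | true  = ≈-sym (≈-trans (*-𝟙ʳ _ _) (reflexive (guard-∧ (distinct (φ σ′)) (ok σ′) _)))
    ... | false rewrite δB-φ≢ σ′ σ (≡.trans (cong (φ σ′ ==L_) (Signing-φ s)) φσ′≡τ) =
      ≈-trans (guard-cong (distinct (φ σ′)) (guard-0# (ok σ′))) (guard-0# (distinct (φ σ′)))

  sumS-at : ∀ n (ok : List ℕ → Bool) τ →
            sumS (filter (λ τ′ → ok τ′ Data.Bool.≟ true) (Sn n)) τ ≈ guard (isPerm n τ) (𝟙 (ok τ))
  sumS-at n ok τ = begin
    ΣR (filter (λ τ′ → ok τ′ Data.Bool.≟ true) (Sn n)) (λ τ′ → 𝟙 (τ′ ==L τ))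
      ≈⟨ ΣR-filter ok (Sn n) _ ⟩
    ΣR (Sn n) (λ τ′ → guard (ok τ′) (𝟙 (τ′ ==L τ)))
      ≈⟨ ΣR-filter distinct (words (map suc (upTo n)) n) _ ⟩
    ΣR (words (map suc (upTo n)) n) (λ τ′ → guard (distinct τ′) (guard (ok τ′) (𝟙 (τ′ ==L τ))))
      ≈⟨ ΣR-cong (words (map suc (upTo n)) n) only-τ ⟩
    ΣR (words (map suc (upTo n)) n) (λ τ′ → guard (τ′ ==L τ) (𝟙 (distinct τ ∧ ok τ)))
      ≈⟨ ΣR-positiveWords n n τ _ ⟩
    guard (isWord n n τ) (𝟙 (distinct τ ∧ ok τ))
      ≡⟨ ≡.trans (cong (guard (isWord n n τ)) (guard-∧ (distinct τ) (ok τ) 1#))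
                 (≡.sym (guard-∧ (isWord n n τ) _ _)) ⟩
    guard (isPerm n τ) (𝟙 (ok τ)) ∎
    where
    only-τ : ∀ τ′ → guard (distinct τ′) (guard (ok τ′) (𝟙 (τ′ ==L τ)))
                    ≈ guard (τ′ ==L τ) (𝟙 (distinct τ ∧ ok τ))
    only-τ τ′ with τ′ ==L τ in τ′≡τ
    ... | true rewrite ==L-sound τ′ τ τ′≡τ = reflexive (≡.sym (guard-∧ (distinct τ) (ok τ) 1#))
    ... | false = ≈-trans (guard-cong (distinct τ′) (guard-0# (ok τ′))) (guard-0# (distinct τ′))

  φlin-at : ∀ n (x : RB) τ →
            φlin n x τ ≈ guard (isWord n n τ) (ΣR (signings τ) (λ σ → guard (distinct τ) (x σ)))
  φlin-at n x τ = begin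
    ΣR (Bn n) (λ σ → guard (φ σ ==L τ) (x σ))
      ≈⟨ ΣR-filter (distinct ∘ φ) (words (signedVals n) n) _ ⟩
    ΣR (words (signedVals n) n) (λ σ → guard (distinct (φ σ)) (guard (φ σ ==L τ) (x σ)))
      ≈⟨ ΣR-cong (words (signedVals n) n) distinct-fibre ⟩
    ΣR (words (signedVals n) n) (λ σ → guard (φ σ ==L τ) (guard (distinct τ) (x σ)))
      ≈⟨ ΣR-signedWords n n τ _ ⟩
    guard (isWord n n τ) (ΣR (signings τ) (λ σ → guard (distinct τ) (x σ))) ∎
    where
    distinct-fibre : ∀ σ → guard (distinct (φ σ)) (guard (φ σ ==L τ) (x σ))
                           ≈ guard (φ σ ==L τ) (guard (distinct τ) (x σ))
    distinct-fibre σ with φ σ ==L τ in φσ≡τ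
    ... | true rewrite ==L-sound (φ σ) τ φσ≡τ = ≈-refl
    ... | false = guard-0# (distinct (φ σ))

  isNeg : ℤ → Bool
  isNeg (+ _)    = false
  isNeg -[1+ _ ] = true

  -- Closed form of ΣR-signings-descents⊆: besides the free peaks, an unflagged first descent from p
  -- can only be met by p < 0, and then it constrains no sign of τ, whence the extra factor 2.
  signingCount : (negative noPeak descent : Bool) → ℕ → Carrier
  signingCount negative noPeak descent k = guard noPeak (if descent then guard negative (pow two (suc k)) else pow two k)

  signingCount-both-signs : ∀ N F k → signingCount false N F k + signingCount true N F k ≈ guard N (pow two (suc k))
  signingCount-both-signs false F     k = +-identityˡ 0#
  signingCount-both-signs true  true  k = +-identityˡ _
  signingCount-both-signs true  false k =
    ≈-sym (≈-trans (distribʳ (pow two k) 1# 1#) (+-cong (*-identityˡ _) (*-identityˡ _)))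

  signingCount-ascent : ∀ N F k → signingCount false N F k + 0# ≈ guard (not F ∧ N) (pow two k)
  signingCount-ascent N true  k = ≈-trans (+-identityʳ _) (guard-0# N)
  signingCount-ascent N false k = +-identityʳ _

  signingCount-step : ∀ {m} p t j (J : Vec Bool m) N F → ℤ.∣ p ∣ ≢ suc t →
    guard (not (+ suc t <ᶻ p) ∨ j) (signingCount false N F ∣ J ∣)
      + guard (not (-[1+ t ] <ᶻ p) ∨ j) (signingCount true N F ∣ J ∣)
    ≈ signingCount (isNeg p) (not ((not j ∧ (ℤ.∣ p ∣ ℕ.<ᵇ suc t)) ∧ F) ∧ N)
                             (not j ∧ (suc t ℕ.<ᵇ ℤ.∣ p ∣)) ∣ j ∷ J ∣
  signingCount-step (+ q) t j J N F q≢1+t rewrite <ᵇ-flip (suc t) q (q≢1+t ∘ ≡.sym) with q ℕ.<ᵇ suc t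
  signingCount-step (+ q) t true  J N F _ | true  = signingCount-both-signs N F ∣ J ∣
  signingCount-step (+ q) t true  J N F _ | false = signingCount-both-signs N F ∣ J ∣
  signingCount-step (+ q) t false J N F _ | true  = signingCount-ascent N F ∣ J ∣
  signingCount-step (+ q) t false J N F _ | false = ≈-trans (+-identityˡ 0#) (≈-sym (guard-0# N))
  signingCount-step -[1+ q ] t j J N F q≢t rewrite <ᵇ-flip t q (q≢t ∘ cong suc ∘ ≡.sym) with q ℕ.<ᵇ t
  signingCount-step -[1+ q ] t true  J N F _ | true  = signingCount-both-signs N F ∣ J ∣
  signingCount-step -[1+ q ] t true  J N F _ | false = signingCount-both-signs N F ∣ J ∣
  signingCount-step -[1+ q ] t false J N F _ | true  = signingCount-ascent N F ∣ J ∣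
  signingCount-step -[1+ q ] t false J N F _ | false = signingCount-both-signs N F ∣ J ∣

  ΣR-signings-descents⊆ : ∀ {m} p τ (J : Vec Bool m) →
    length τ ≡ m → AllPositive τ → Linked _≢_ (ℤ.∣ p ∣ ∷ τ) →
    ΣR (signings τ) (λ σ → 𝟙 (descents⊆ p σ J))
    ≈ signingCount (isNeg p) (noFreePeak ℤ.∣ p ∣ τ J) (freeDescent ℤ.∣ p ∣ τ J) ∣ J ∣
  ΣR-signings-descents⊆ p []          []      _     _        _                 = +-identityʳ 1#
  ΣR-signings-descents⊆ p (suc t ∷ τ) (j ∷ J) ∣τ∣≡m (t ∷ ps) (p≢1+t ∷ linked) = begin
    ΣR (signings (suc t ∷ τ)) (λ σ → 𝟙 (descents⊆ p σ (j ∷ J)))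
      ≈⟨ ΣR-signings-suc t τ _ ⟩
    ΣR (signings τ) (λ σ → 𝟙 (descents⊆ p (+ suc t ∷ σ) (j ∷ J)))
      + ΣR (signings τ) (λ σ → 𝟙 (descents⊆ p (-[1+ t ] ∷ σ) (j ∷ J)))
      ≈⟨ +-cong (first-step (+ suc t) linked) (first-step -[1+ t ] linked) ⟩
    guard (not (+ suc t <ᶻ p) ∨ j) (signingCount false N F ∣ J ∣)
      + guard (not (-[1+ t ] <ᶻ p) ∨ j) (signingCount true N F ∣ J ∣)
      ≈⟨ signingCount-step p t j J N F p≢1+t ⟩
    signingCount (isNeg p) (noFreePeak ℤ.∣ p ∣ (suc t ∷ τ) (j ∷ J))
                           (freeDescent ℤ.∣ p ∣ (suc t ∷ τ) (j ∷ J)) ∣ j ∷ J ∣ ∎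
    where
    N = noFreePeak (suc t) τ J
    F = freeDescent (suc t) τ J
    count : ℤ → Carrier
    count a = signingCount (isNeg a) (noFreePeak ℤ.∣ a ∣ τ J) (freeDescent ℤ.∣ a ∣ τ J) ∣ J ∣
    first-step : ∀ a → Linked _≢_ (ℤ.∣ a ∣ ∷ τ) →
      ΣR (signings τ) (λ σ → 𝟙 (descents⊆ p (a ∷ σ) (j ∷ J))) ≈ guard (not (a <ᶻ p) ∨ j) (count a)
    first-step a linked′ = begin
      ΣR (signings τ) (λ σ → 𝟙 (descents⊆ p (a ∷ σ) (j ∷ J)))
        ≈⟨ ΣR-cong (signings τ) (λ σ → reflexive (guard-∧ (not (a <ᶻ p) ∨ j) _ 1#)) ⟩
      ΣR (signings τ) (λ σ → guard (not (a <ᶻ p) ∨ j) (𝟙 (descents⊆ a σ J)))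
        ≈⟨ ΣR-guard (signings τ) (not (a <ᶻ p) ∨ j) _ ⟩
      guard (not (a <ᶻ p) ∨ j) (ΣR (signings τ) (λ σ → 𝟙 (descents⊆ a σ J)))
        ≈⟨ guard-cong (not (a <ᶻ p) ∨ j) (ΣR-signings-descents⊆ a τ J (cong ℕ.pred ∣τ∣≡m) ps linked′) ⟩
      guard (not (a <ᶻ p) ∨ j) (count a) ∎

  φX-at : ∀ n J τ → φlin n (X n J) τ ≈ guard (isPerm n τ) (ΣR (signings τ) (λ σ → 𝟙 (subsetB (Des n σ) J)))
  φX-at n J τ = begin
    φlin n (X n J) τ
      ≈⟨ φlin-at n (X n J) τ ⟩
    guard W (ΣR (signings τ) (λ σ → guard D (X n J σ)))
      ≈⟨ guard-under W (λ w → ΣR-signings-cong (isWord-positive n n τ w) (λ σ s → guard-cong D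
           (≈-trans (sumB-at-signing n (λ σ → subsetB (Des n σ) J) s)
                    (reflexive (cong (λ b → guard b (𝟙 (D ∧ subsetB (Des n σ) J))) w))))) ⟩
    guard W (ΣR (signings τ) (λ σ → guard D (𝟙 (D ∧ subsetB (Des n σ) J))))
      ≈⟨ guard-cong W (ΣR-cong (signings τ) (λ σ → reflexive (guard-𝟙-∧ D _))) ⟩
    guard W (ΣR (signings τ) (λ σ → guard D (𝟙 (subsetB (Des n σ) J))))
      ≈⟨ guard-cong W (ΣR-guard (signings τ) D _) ⟩
    guard W (guard D (ΣR (signings τ) (λ σ → 𝟙 (subsetB (Des n σ) J))))
      ≡⟨ guard-∧ W D _ ⟨
    guard (isPerm n τ) (ΣR (signings τ) (λ σ → 𝟙 (subsetB (Des n σ) J))) ∎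
    where
    W = isWord n n τ
    D = distinct τ

  ΣR-signings-Des⊆ : ∀ n J τ → isPerm n τ ≡ true →
    ΣR (signings τ) (λ σ → 𝟙 (subsetB (Des n σ) J)) ≈ guard (emptyᵇ (freePeaks J τ)) (pow two ∣ J ∣)
  ΣR-signings-Des⊆ n J τ perm = begin
    ΣR (signings τ) (λ σ → 𝟙 (subsetB (Des n σ) J))
      ≈⟨ ΣR-signings-cong positive (λ σ s → reflexive
           (cong 𝟙 (subsetB-Des≡descents⊆ n J σ (≡.trans (Signing-length s) ∣τ∣≡n)))) ⟩
    ΣR (signings τ) (λ σ → 𝟙 (descents⊆ (+ 0) σ J))
      ≈⟨ ΣR-signings-descents⊆ (+ 0) τ J ∣τ∣≡n positive
           (positive-distinct⇒linked τ positive (∧-conicalʳ (isWord n n τ) _ perm)) ⟩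
    signingCount false (noFreePeak 0 τ J) (freeDescent 0 τ J) ∣ J ∣
      ≡⟨ cong₂ (λ N F → signingCount false N F ∣ J ∣)
               (≡.sym (emptyᵇ-freePeaks n τ J ∣τ∣≡n)) (freeDescent-0 τ J) ⟩
    guard (emptyᵇ (freePeaks J τ)) (pow two ∣ J ∣) ∎
    where
    word = ∧-conicalˡ (isWord n n τ) _ perm
    positive = isWord-positive n n τ word
    ∣τ∣≡n = isWord-length n n τ word

  Q-at : ∀ n G τ → Q n G τ ≈ guard (isPerm n τ) (𝟙 (subsetB G (Peak n τ)))
  Q-at n G τ = begin
    ΣR (SparseSets n) (λ H → guard (subsetB G H) (P n H τ))
      ≈⟨ ΣR-cong (SparseSets n) (λ H → ≈-trans
           (guard-cong (subsetB G H) (sumS-at n (λ τ′ → eqSubsetB (Peak n τ′) H) τ))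
           (reflexive (guard-comm (subsetB G H) V _))) ⟩
    ΣR (SparseSets n) (λ H → guard V (guard (subsetB G H) (𝟙 (eqSubsetB Pk H))))
      ≈⟨ ΣR-guard (SparseSets n) V _ ⟩
    guard V (ΣR (SparseSets n) (λ H → guard (subsetB G H) (𝟙 (eqSubsetB Pk H))))
      ≈⟨ guard-cong V (ΣR-filter (λ H → inPositive H ∧ sparse H) (allSubsets n) _) ⟩
    guard V (ΣR (allSubsets n) (λ H → guard (inPositive H ∧ sparse H) (guard (subsetB G H) (𝟙 (eqSubsetB Pk H)))))
      ≈⟨ guard-cong V (ΣR-cong (allSubsets n) only-Peak) ⟩
    guard V (ΣR (allSubsets n) (λ H → guard (eqSubsetB Pk H) (𝟙 (subsetB G Pk))))
      ≈⟨ guard-cong V (ΣR-eqSubsetB n Pk _) ⟩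
    guard V (𝟙 (subsetB G Pk)) ∎
    where
    V = isPerm n τ
    Pk = Peak n τ
    only-Peak : ∀ H → guard (inPositive H ∧ sparse H) (guard (subsetB G H) (𝟙 (eqSubsetB Pk H)))
                      ≈ guard (eqSubsetB Pk H) (𝟙 (subsetB G Pk))
    only-Peak H with eqSubsetB Pk H in Pk≡H
    ... | false = ≈-trans (guard-cong (inPositive H ∧ sparse H) (guard-0# (subsetB G H)))
                          (guard-0# (inPositive H ∧ sparse H))
    ... | true with eqSubsetB-sound Pk H Pk≡H
    ...   | refl rewrite subsetB-Peak⇒sparse τ Pk (subsetB-refl Pk) = ≈-refl

  rhs-sum-at : ∀ n J τ → ΣR (SparseSets n) (λ G → guard (avoidsJ J G) (pow (- 1#) ∣ G ∣ * Q n G τ))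
                         ≈ guard (isPerm n τ) (𝟙 (emptyᵇ (freePeaks J τ)))
  rhs-sum-at n J τ = begin
    ΣR (SparseSets n) (λ G → guard (avoidsJ J G) (pow (- 1#) ∣ G ∣ * Q n G τ))
      ≈⟨ ΣR-cong (SparseSets n) (λ G → ≈-trans
           (guard-cong (avoidsJ J G) (≈-trans (*-congˡ (Q-at n G τ)) (*-guardˡ V _ _)))
           (reflexive (guard-comm (avoidsJ J G) V _))) ⟩
    ΣR (SparseSets n) (λ G → guard V (guard (avoidsJ J G) (pow (- 1#) ∣ G ∣ * 𝟙 (subsetB G Pk))))
      ≈⟨ ΣR-guard (SparseSets n) V _ ⟩
    guard V (ΣR (SparseSets n) (λ G → guard (avoidsJ J G) (pow (- 1#) ∣ G ∣ * 𝟙 (subsetB G Pk))))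
      ≈⟨ guard-cong V (ΣR-filter (λ G → inPositive G ∧ sparse G) (allSubsets n) _) ⟩
    guard V (ΣR (allSubsets n) (λ G → guard (inPositive G ∧ sparse G)
                                       (guard (avoidsJ J G) (pow (- 1#) ∣ G ∣ * 𝟙 (subsetB G Pk)))))
      ≈⟨ guard-cong V (ΣR-cong (allSubsets n) within-K) ⟩
    guard V (ΣR (allSubsets n) (λ G → guard (subsetB G (dropNear J Pk)) (pow (- 1#) ∣ G ∣)))
      ≈⟨ guard-cong V (ΣR-alternating n (dropNear J Pk)) ⟩
    guard V (𝟙 (emptyᵇ (dropNear J Pk))) ∎
    where
    V = isPerm n τ
    Pk = Peak n τ
    within-K : ∀ G → guard (inPositive G ∧ sparse G) (guard (avoidsJ J G) (pow (- 1#) ∣ G ∣ * 𝟙 (subsetB G Pk)))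
                     ≈ guard (subsetB G (dropNear J Pk)) (pow (- 1#) ∣ G ∣)
    within-K G rewrite subsetB-dropNear J G Pk with subsetB G Pk in G⊆Pk
    ... | true rewrite subsetB-Peak⇒sparse τ G G⊆Pk = guard-cong (avoidsJ J G) (*-identityʳ _)
    ... | false = ≈-trans (guard-cong (inPositive G ∧ sparse G) (≈-trans (guard-cong (avoidsJ J G) (zeroʳ _))
                                                                       (guard-0# (avoidsJ J G))))
                          (guard-0# (inPositive G ∧ sparse G))

proposition1p4 : ∀ {c ℓ} (𝕜 : CommutativeRing c ℓ) → IsField 𝕜 →
                 let open CommutativeRing 𝕜 in ¬ (1# + 1# ≈ 0#) →
                 (n : ℕ) (J : Subset n) (τ : List ℕ) →
                 GroupAlgebra.φlin 𝕜 n (GroupAlgebra.X 𝕜 n J) τ ≈ GroupAlgebra.rhs 𝕜 n J τ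
proposition1p4 𝕜 _ _ n J τ = begin
  φlin n (X n J) τ
    ≈⟨ φX-at n J τ ⟩
  guard (isPerm n τ) (ΣR (signings τ) (λ σ → 𝟙 (subsetB (Des n σ) J)))
    ≈⟨ guard-under (isPerm n τ) (ΣR-signings-Des⊆ n J τ) ⟩
  guard (isPerm n τ) (guard (emptyᵇ K) (pow two ∣ J ∣))
    ≈⟨ guard-cong (isPerm n τ) (*-𝟙ʳ (emptyᵇ K) (pow two ∣ J ∣)) ⟨
  guard (isPerm n τ) (pow two ∣ J ∣ * 𝟙 (emptyᵇ K))
    ≈⟨ *-guardˡ (isPerm n τ) (pow two ∣ J ∣) _ ⟨
  pow two ∣ J ∣ * guard (isPerm n τ) (𝟙 (emptyᵇ K))
    ≈⟨ *-congˡ (rhs-sum-at n J τ) ⟨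
  rhs n J τ ∎
  where
  open CommutativeRing 𝕜 using (_*_; *-congˡ; setoid)
  open SetoidReasoning setoid
  open GroupAlgebra 𝕜
  open Coefficients 𝕜
  K = freePeaks J τ
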